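{- Let $C>0$, let $k>1$ be an integer, and let $T$ satisfy $0<T<C/k$; set $r=kT/C$. Then the online algorithm $\textsc{FlushWhenFull}$ is $\frac{k+1}{k(1-r)}$-competitive in the discrete $k$-wallet model $\mathcal{M}^{C,k}_T$: there is a constant $c$ depending only on the model parameters such that for every transaction sequence $\mathsf{Tx}$ with all values at most $T$, \[ V_{\mathrm{OPT}}(\mathsf{Tx}) \le \frac{k+1}{k(1-r)}\, V_{\textsc{FlushWhenFull}}(\mathsf{Tx}) + c. \]
   Context: Discrete $k$-wallet model $\mathcal{M}^{C,k}_T$: Time is divided into discrete slots $t=1,2,\dots$. A transaction sequence is $\mathsf{Tx}=(\mathsf{tx}_1,\dots,\mathsf{tx}_n)$, where $\mathsf{tx}_t\in[0,T]$ is the value of the transaction arriving at slot $t$ (value $0$ means no transaction). A total collateral $C$ is divided into $k$ wallets, each of capacity $C/k$. Each wallet is either online with some available (uncommitted) collateral $R\in[0,C/k]$, or offline. When a transaction of value $v$ arrives, the policy must immediately either settle it, using an online wallet with $R\ge v$ (whose available collateral becomes $R-v$), or discard it. At any time $t$ the policy may flush a wallet; the wallet is then offline during the slots of the interval $(t,t+F]$ (with $F$ a fixed positive integer flush period), after which it is online again with available collateral reset to $C/k$. For a policy $\mathrm{A}$, $V_{\mathrm{A}}(\mathsf{Tx})$ denotes the total value of transactions it settles. An algorithm is online if its decisions at time $N$ depend only on $\mathsf{tx}_1,\dots,\mathsf{tx}_N$. $\mathrm{OPT}$ denotes an optimal offline $k$-wallet policy, i.e. $V_{\mathrm{OPT}}(\mathsf{Tx})$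 is the maximum settled value achievable by any $k$-wallet policy with full knowledge of $\mathsf{Tx}$. An algorithm $\mathrm{A}$ is $\alpha$-competitive in this model if for every sequence $\mathsf{Tx}$ with values at most $T$, $V_{\mathrm{OPT}}(\mathsf{Tx})\le \alpha V_{\mathrm{A}}(\mathsf{Tx})+O(1)$, where the $O(1)$ constant may depend on $C,k,T$ (and $F$) but not on $\mathsf{Tx}$ or its length. Algorithm $\textsc{FlushWhenFull}$: the wallets are used one at a time in a fixed cyclic (round-robin) order. The current active wallet settles each arriving transaction as long as it fits. When a transaction arrives that does not fit in the active wallet, that wallet is immediately flushed and the next wallet in cyclic order becomes the active wallet (if it is online, it handles the transaction); if the next wallet is still offline (in its flush period), the algorithm waits for it to come back online, discarding all transactions arriving during this wait.
   Formalization: The total collateral $C$, the bound $T$ and the transaction values are rational rather than real. -}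

module Defs where

open import Data.Nat as ℕ using (ℕ; zero; suc)
open import Data.Fin using (Fin; zero; suc)
open import Data.Bool using (Bool; true; false)
open import Data.Maybe using (Maybe; just; nothing)
open import Data.List using (List; []; _∷_)
open import Data.Vec using (Vec; lookup; _[_]≔_; replicate; zipWith; map)
open import Data.Product using (Σ; ∃; _×_; _,_)
open import Data.Integer using (+_)
open import Data.Rational using (ℚ; 0ℚ; _+_; _-_; _/_; _÷_; ≢-nonZero)
open import Data.Rational.Properties using (_≟_; _≤?_)
open import Relation.Nullary using (yes; no)
open import Relation.Binary.PropositionalEquality using (_≡_)

-- total division on ℚ (p ÷₀ 0 = 0); agrees with _÷_ whenever q ≠ 0
_÷₀_ : ℚ → ℚ → ℚ
p ÷₀ q with q ≟ 0ℚ
... | yes _   = 0ℚ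
... | no q≢0 = _÷_ p q {{≢-nonZero q≢0}}

ℕ→ℚ : ℕ → ℚ
ℕ→ℚ n = (+ n) / 1

-- State of a wallet at the start of a slot.
--   online R  : online, with available (uncommitted) collateral R
--   offline n : offline in the current slot and in the n following slots
data Wallet : Set where
  online  : ℚ → Wallet
  offline : ℕ → Wallet

Wallets : ℕ → Set
Wallets k = Vec Wallet k

cap : ℚ → ℕ → ℚ
cap C k = C ÷₀ ℕ→ℚ k

initial : ℚ → (k : ℕ) → Wallets k
initial C k = replicate k (online (cap C k))

settleW : ℚ → Wallet → Maybe Wallet
settleW v (online R) with v ≤? R
... | yes _ = just (online (R - v))
... | no  _ = nothing
settleW v (offline _) = nothing

-- flushing an (online) wallet at slot t: marked offline F, which after the
-- end-of-slot tick means offline during the F slots t+1,…,t+F.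
-- Flushing an already offline wallet has no effect.
flushW : ℕ → Bool → Wallet → Wallet
flushW F true  (online _)  = offline F
flushW F true  (offline n) = offline n
flushW F false w           = w

tick : ℚ → Wallet → Wallet
tick c (online R)        = online R
tick c (offline zero)    = online c
tick c (offline (suc n)) = offline n

endSlot : ∀ {k} → ℚ → ℕ → Vec Bool k → Wallets k → Wallets k
endSlot c F fl ws = map (tick c) (zipWith (flushW F) fl ws)

record Decision (k : ℕ) : Set where
  constructor decide
  field
    settle : Maybe (Fin k)
    flush  : Vec Bool k

-- an offline policy (full knowledge of Tx) is a decision for every slot
Policy : ℕ → Set
Policy k = ℕ → Decision k

-- total settled value of a policy, or nothing if the policy is not valid
-- (tries to settle in an offline wallet or one with too little collateral)
runPolicy : (C : ℚ) (k F : ℕ) → Policy k → ℕ → Wallets k → List ℚ → Maybe ℚ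
runPolicy C k F P t ws [] = just 0ℚ
runPolicy C k F P t ws (v ∷ tx) with Decision.settle (P t)
... | nothing =
  runPolicy C k F P (suc t) (endSlot (cap C k) F (Decision.flush (P t)) ws) tx
... | just i with settleW v (lookup ws i)
...   | nothing = nothing
...   | just w  = Data.Maybe.map (λ x → v + x)
          (runPolicy C k F P (suc t)
             (endSlot (cap C k) F (Decision.flush (P t)) (ws [ i ]≔ w)) tx)

-- V is the value settled by some valid k-wallet policy on Tx
-- (V_OPT(Tx) is the maximum of all such V)
Achievable : (C : ℚ) (k F : ℕ) → List ℚ → ℚ → Set
Achievable C k F tx V = Σ (Policy k) λ P → runPolicy C k F P 0 (initial C k) tx ≡ just V

next : ∀ {n} → Fin (suc n) → Fin (suc n)
next {zero}  zero    = zero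
next {suc n} zero    = suc zero
next {suc n} (suc i) with next {n} i
... | zero  = zero
... | suc j = suc (suc j)

noFlush : ∀ {k} → Vec Bool k
noFlush {k} = replicate k false

mutual
  -- a : currently active wallet
  runFWF : (c : ℚ) (F : ℕ) {m : ℕ} → Fin (suc m) → Wallets (suc m) → List ℚ → ℚ
  runFWF c F a ws []       = 0ℚ
  runFWF c F a ws (v ∷ tx) = fwfSlot c F a ws v tx (lookup ws a)

  fwfSlot : (c : ℚ) (F : ℕ) {m : ℕ} → Fin (suc m) → Wallets (suc m) → ℚ → List ℚ → Wallet → ℚ
  fwfSlot c F a ws v tx (offline _) = runFWF c F a (endSlot c F noFlush ws) tx
  fwfSlot c F a ws v tx (online R) with settleW v (online R)
  ... | just w  = v + runFWF c F a (endSlot c F noFlush (ws [ a ]≔ w)) tx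
  ... | nothing with settleW v (lookup ws (next a))
  ...   | just w  = v + runFWF c F (next a)
                          (endSlot c F (noFlush [ a ]≔ true) (ws [ next a ]≔ w)) tx
  ...   | nothing = runFWF c F (next a)
                          (endSlot c F (noFlush [ a ]≔ true) ws) tx

V-FWF : (C : ℚ) (k F : ℕ) → List ℚ → ℚ
V-FWF C zero    F tx = 0ℚ
V-FWF C (suc m) F tx = runFWF (cap C (suc m)) F zero (initial C (suc m)) tx

module Submission where

open import Data.Bool using (Bool; true; false)
open import Data.Fin as Fin using (Fin; zero; suc; toℕ)
import Data.Fin.Properties as Fin
import Data.Integer as ℤ
import Data.Integer.Tactic.RingSolver as ℤ-Solver
open import Data.List using (List; []; _∷_)
open import Data.List.Relation.Unary.All using (All; []; _∷_)
open import Data.Maybe using (just; nothing)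
open import Data.Maybe.Properties using (just-injective)
open import Data.Nat as ℕ using (ℕ; zero; suc; _∸_; _%_)
open import Data.Nat.DivMod using (m<n⇒m%n≡m; [m+n]%n≡m%n; m≤n⇒[n∸m]%m≡n%m)
import Data.Nat.Properties as ℕ
open import Data.Product using (∃-syntax; _×_; _,_; proj₁; proj₂)
open import Data.Rational
  using (ℚ; 0ℚ; 1ℚ; _≤_; _<_; _+_; _-_; _*_; 1/_; -_; positive; nonNegative; ≢-nonZero; toℚᵘ)
open import Data.Rational.Properties
import Data.Rational.Unnormalised as ℚᵘ
import Data.Rational.Unnormalised.Properties as ℚᵘ
open import Data.Sum using (_⊎_; inj₁; inj₂)
open import Data.Unit using (⊤)
open import Data.Vec using (Vec; []; _∷_; lookup; _[_]≔_; zipWith; replicate)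
import Data.Vec.Properties as Vec
open import Level using (0ℓ)
open import Relation.Binary.PropositionalEquality
open import Relation.Nullary using (yes; no; contradiction)
open import Relation.Nullary.Decidable using (dec⇒maybe)
open import Tactic.RingSolver using (solve-∀)
open import Tactic.RingSolver.Core.AlmostCommutativeRing using (AlmostCommutativeRing; fromCommutativeRing)

open import Defs

-- Amortised analysis.  Run FlushWhenFull (FWF) and an arbitrary policy OPT
-- side by side and track the credit D = α·(value settled by FWF) − (value
-- settled by OPT); it never becomes negative, so the additive constant is 0.
--
-- OPT is controlled by the potential Φₙ, the collateral it could spend within
-- the next n slots: the remainder of its online wallets plus C/k for every
-- offline wallet that returns within n slots.  In one slot OPT gains g with
-- Φₙ(after) + g ≤ Φₙ₊₁(before) for n < F, as a wallet flushed now stays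
-- invisible at these horizons.
--
-- FWF keeps an invariant: its active wallet has spent u with (α − 1)u ≤ D,
-- its other online wallets are full, and if the wallet d steps ahead of the
-- active one is offline for n more slots, then, with B = C/k − T,
--   Φₙ + (α − 1)B + α((k − 1 − d)B + u) ≤ D + C,
-- because since that wallet was flushed FWF has exhausted k − 1 − d wallets,
-- each by at least B (a transaction larger than the remainder arrived).  When
-- FWF has to wait (d = 0) this gives D ≥ Φₙ ≥ g.  This is where the ratio
-- enters, through C + B ≤ α·kB: for α = (k+1)/(k(1−r)) one has α·kB = C + C/k.

-- Iterated on the inside, because switching to the next wallet relies on
-- next^ d (next a) and next^ (suc d) a being definitionally equal.
next^ : ∀ {n} → ℕ → Fin (suc n) → Fin (suc n)
next^ zero    a = a
next^ (suc d) a = next^ d (next a)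

toℕ-next : ∀ {n} (i : Fin (suc n)) →
           (toℕ i ≡ n × toℕ (next i) ≡ 0) ⊎ toℕ (next i) ≡ suc (toℕ i)
toℕ-next {zero}  zero    = inj₁ (refl , refl)
toℕ-next {suc n} zero    = inj₂ refl
toℕ-next {suc n} (suc i) with next {n} i | toℕ-next {n} i
... | zero  | inj₁ (i≡n , _) = inj₁ (cong suc i≡n , refl)
... | suc j | inj₂ eq        = inj₂ (cong suc eq)

toℕ-next^ : ∀ {n} d (a : Fin (suc n)) → toℕ (next^ d a) ≡ (toℕ a ℕ.+ d) % suc n
toℕ-next^ {n} zero a = begin
  toℕ a                     ≡⟨ m<n⇒m%n≡m (Fin.toℕ<n a) ⟨
  toℕ a % suc n             ≡⟨ cong (_% suc n) (ℕ.+-identityʳ (toℕ a)) ⟨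
  (toℕ a ℕ.+ 0) % suc n     ∎
  where open ≡-Reasoning
toℕ-next^ {n} (suc d) a with toℕ-next a
... | inj₁ (a≡n , next≡0) = begin
  toℕ (next^ d (next a))              ≡⟨ toℕ-next^ d (next a) ⟩
  (toℕ (next a) ℕ.+ d) % suc n        ≡⟨ cong (λ x → (x ℕ.+ d) % suc n) next≡0 ⟩
  d % suc n                           ≡⟨ [m+n]%n≡m%n d (suc n) ⟨
  (d ℕ.+ suc n) % suc n               ≡⟨ cong (_% suc n) (ℕ.+-comm d (suc n)) ⟩
  (suc n ℕ.+ d) % suc n               ≡⟨ cong (λ x → (suc x ℕ.+ d) % suc n) a≡n ⟨
  (suc (toℕ a) ℕ.+ d) % suc n         ≡⟨ cong (_% suc n) (ℕ.+-suc (toℕ a) d) ⟨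
  (toℕ a ℕ.+ suc d) % suc n           ∎
  where open ≡-Reasoning
... | inj₂ next≡suc = begin
  toℕ (next^ d (next a))              ≡⟨ toℕ-next^ d (next a) ⟩
  (toℕ (next a) ℕ.+ d) % suc n        ≡⟨ cong (λ x → (x ℕ.+ d) % suc n) next≡suc ⟩
  (suc (toℕ a) ℕ.+ d) % suc n         ≡⟨ cong (_% suc n) (ℕ.+-suc (toℕ a) d) ⟨
  (toℕ a ℕ.+ suc d) % suc n           ∎
  where open ≡-Reasoning

next^-period : ∀ {n} (a : Fin (suc n)) → next^ (suc n) a ≡ a
next^-period {n} a = Fin.toℕ-injective (begin
  toℕ (next^ (suc n) a)          ≡⟨ toℕ-next^ (suc n) a ⟩
  (toℕ a ℕ.+ suc n) % suc n      ≡⟨ [m+n]%n≡m%n (toℕ a) (suc n) ⟩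
  toℕ a % suc n                  ≡⟨ m<n⇒m%n≡m (Fin.toℕ<n a) ⟩
  toℕ a                          ∎)
  where open ≡-Reasoning

next^-aperiodic : ∀ {n} d (a : Fin (suc n)) → suc d ℕ.≤ n → next^ (suc d) a ≢ a
next^-aperiodic {n} d a sd≤n eq with toℕ a ℕ.+ suc d ℕ.<? suc n
... | yes no-wrap = ℕ.m+1+n≢m (toℕ a) (begin
  toℕ a ℕ.+ suc d                ≡⟨ m<n⇒m%n≡m no-wrap ⟨
  (toℕ a ℕ.+ suc d) % suc n      ≡⟨ toℕ-next^ (suc d) a ⟨
  toℕ (next^ (suc d) a)          ≡⟨ cong toℕ eq ⟩
  toℕ a                          ∎)
  where open ≡-Reasoning
... | no wrap = ℕ.<-irrefl (ℕ.+-cancelˡ-≡ (toℕ a) (suc d) (suc n) sum≡) (ℕ.s≤s sd≤n)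
  where
  open ≡-Reasoning
  k≤sum : suc n ℕ.≤ toℕ a ℕ.+ suc d
  k≤sum = ℕ.≮⇒≥ wrap
  wrapped<k : toℕ a ℕ.+ suc d ∸ suc n ℕ.< suc n
  wrapped<k = ℕ.+-cancelʳ-< (suc n) _ (suc n)
    (subst (ℕ._< suc n ℕ.+ suc n) (sym (ℕ.m∸n+n≡m k≤sum))
      (ℕ.+-mono-< (Fin.toℕ<n a) (ℕ.s≤s sd≤n)))
  wrapped≡a : toℕ a ℕ.+ suc d ∸ suc n ≡ toℕ a
  wrapped≡a = begin
    toℕ a ℕ.+ suc d ∸ suc n               ≡⟨ m<n⇒m%n≡m wrapped<k ⟨
    (toℕ a ℕ.+ suc d ∸ suc n) % suc n     ≡⟨ m≤n⇒[n∸m]%m≡n%m k≤sum ⟩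
    (toℕ a ℕ.+ suc d) % suc n             ≡⟨ toℕ-next^ (suc d) a ⟨
    toℕ (next^ (suc d) a)                 ≡⟨ cong toℕ eq ⟩
    toℕ a                                 ∎
  sum≡ : toℕ a ℕ.+ suc d ≡ toℕ a ℕ.+ suc n
  sum≡ = begin
    toℕ a ℕ.+ suc d                       ≡⟨ ℕ.m∸n+n≡m k≤sum ⟨
    (toℕ a ℕ.+ suc d ∸ suc n) ℕ.+ suc n   ≡⟨ cong (ℕ._+ suc n) wrapped≡a ⟩
    toℕ a ℕ.+ suc n                       ∎

next^-return : ∀ {n} d (a : Fin (suc n)) → d ℕ.≤ n → next^ (suc d) a ≡ a → d ≡ n
next^-return d a d≤n returns with ℕ.m≤n⇒m<n∨m≡n d≤n
... | inj₁ d<n = contradiction returns (next^-aperiodic d a d<n)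
... | inj₂ d≡n = d≡n

next^-no-return : ∀ {n} d (a : Fin (suc n)) → d ℕ.≤ n → next^ (suc d) a ≢ a → suc d ℕ.≤ n
next^-no-return d a d≤n ¬returns with ℕ.m≤n⇒m<n∨m≡n d≤n
... | inj₁ d<n  = d<n
... | inj₂ refl = contradiction (next^-period a) ¬returns

next≢ : ∀ {n} (a : Fin (suc (suc n))) → next a ≢ a
next≢ a = next^-aperiodic 0 a (ℕ.s≤s ℕ.z≤n)

-- The zero test lets the ring solver cancel coefficients such as 1 − 1.
ℚ-ring : AlmostCommutativeRing 0ℓ 0ℓ
ℚ-ring = fromCommutativeRing +-*-commutativeRing (λ x → dec⇒maybe (0ℚ ≟ x))

p≤q⇒0≤q-p : ∀ {p q} → p ≤ q → 0ℚ ≤ q - p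
p≤q⇒0≤q-p {p} {q} p≤q = subst (_≤ q - p) (+-inverseʳ p) (+-monoˡ-≤ (- p) p≤q)

-- Linear inequalities are proved by writing the larger side as the smaller
-- one plus a sum of nonnegative slacks and checking that identity by ring.
≤-from-slack : ∀ {p q} s → 0ℚ ≤ s → q ≡ p + s → p ≤ q
≤-from-slack {p} s 0≤s refl = subst (_≤ p + s) (+-identityʳ p) (+-monoʳ-≤ p 0≤s)

p-q≤p : ∀ p {q} → 0ℚ ≤ q → p - q ≤ p
p-q≤p p {q} 0≤q = ≤-from-slack q 0≤q (sym (p-q+q p q))
  where p-q+q : ∀ p q → p - q + q ≡ p
        p-q+q = solve-∀ ℚ-ring

*-nonNeg : ∀ {p q} → 0ℚ ≤ p → 0ℚ ≤ q → 0ℚ ≤ p * q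
*-nonNeg {p} {q} 0≤p 0≤q =
  nonNegative⁻¹ (p * q) {{nonNeg*nonNeg⇒nonNeg p {{nonNegative 0≤p}} q {{nonNegative 0≤q}}}}

÷₀-*-cancel : ∀ p {q} → q ≢ 0ℚ → (p ÷₀ q) * q ≡ p
÷₀-*-cancel p {q} q≢0 with q ≟ 0ℚ
... | yes q≡0 = contradiction q≡0 q≢0
... | no _    = begin
  p * (1/ q) * q     ≡⟨ *-assoc p (1/ q) q ⟩
  p * (1/ q * q)     ≡⟨ cong (p *_) (*-inverseˡ q) ⟩
  p * 1ℚ             ≡⟨ *-identityʳ p ⟩
  p                  ∎
  where open ≡-Reasoning
        instance _ = ≢-nonZero q≢0

ℕ→ℚ-suc : ∀ n → ℕ→ℚ (suc n) ≡ 1ℚ + ℕ→ℚ n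
ℕ→ℚ-suc n = toℚᵘ-injective (begin-equality
  toℚᵘ (ℕ→ℚ (suc n))               ≃⟨ toℚᵘ-fromℚᵘ (ℤ.+ suc n ℚᵘ./ 1) ⟩
  ℤ.+ suc n ℚᵘ./ 1                  ≃⟨ ℚᵘ.*≡* (1+i-over-1 (ℤ.+ n)) ⟩
  ℚᵘ.1ℚᵘ ℚᵘ.+ ℤ.+ n ℚᵘ./ 1          ≃⟨ ℚᵘ.+-congʳ ℚᵘ.1ℚᵘ (toℚᵘ-fromℚᵘ (ℤ.+ n ℚᵘ./ 1)) ⟨
  toℚᵘ 1ℚ ℚᵘ.+ toℚᵘ (ℕ→ℚ n)         ≃⟨ toℚᵘ-homo-+ 1ℚ (ℕ→ℚ n) ⟨
  toℚᵘ (1ℚ + ℕ→ℚ n)                 ∎)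
  where
  open ℚᵘ.≤-Reasoning
  1+i-over-1 : ∀ i →
    (ℤ.1ℤ ℤ.+ i) ℤ.* (ℤ.1ℤ ℤ.* ℤ.1ℤ) ≡ (ℤ.1ℤ ℤ.* ℤ.1ℤ ℤ.+ i ℤ.* ℤ.1ℤ) ℤ.* ℤ.1ℤ
  1+i-over-1 = ℤ-Solver.solve-∀

ℕ→ℚ-suc-* : ∀ n x → ℕ→ℚ (suc n) * x ≡ x + ℕ→ℚ n * x
ℕ→ℚ-suc-* n x = trans (cong (_* x) (ℕ→ℚ-suc n)) (distrib x (ℕ→ℚ n))
  where distrib : ∀ x y → (1ℚ + y) * x ≡ x + y * x
        distrib = solve-∀ ℚ-ring

ℕ→ℚ-pos : ∀ n → 0ℚ < ℕ→ℚ (suc n)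
ℕ→ℚ-pos n = positive⁻¹ (ℕ→ℚ (suc n)) {{normalize-pos (suc n) 1}}

ℕ→ℚ-*-cap : ∀ C m → ℕ→ℚ (suc m) * cap C (suc m) ≡ C
ℕ→ℚ-*-cap C m = trans (*-comm (ℕ→ℚ (suc m)) (cap C (suc m)))
                      (÷₀-*-cancel C (λ K≡0 → <-irrefl (sym K≡0) (ℕ→ℚ-pos m)))

credit-shift : ∀ {x x′ g K K′ D C e} → x′ + g ≤ x → x + K ≤ D + C → K′ ≤ K + e →
               x′ + K′ ≤ (D + e - g) + C
credit-shift {x} {x′} {g} {K} {K′} {D} {C} {e} x′+g≤x x+K≤D+C K′≤K+e = ≤-from-slack _
  (+-mono-≤ (p≤q⇒0≤q-p x′+g≤x) (+-mono-≤ (p≤q⇒0≤q-p K′≤K+e) (p≤q⇒0≤q-p x+K≤D+C)))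
  (slacks x x′ g K K′ D C e)
  where
  slacks : ∀ x x′ g K K′ D C e →
           (D + e - g) + C ≡ (x′ + K′) + ((x - (x′ + g)) + ((K + e - K′) + (D + C - (x + K))))
  slacks = solve-∀ ℚ-ring

fresh-credit : ∀ {x x′ g C b D e} → x′ + g ≤ x → x ≤ C → b ≤ D →
               x′ + (b + e) ≤ (D + e - g) + C
fresh-credit {x} {x′} {g} {C} {b} {D} {e} x′+g≤x x≤C b≤D = ≤-from-slack _
  (+-mono-≤ (p≤q⇒0≤q-p x′+g≤x) (+-mono-≤ (p≤q⇒0≤q-p x≤C) (p≤q⇒0≤q-p b≤D)))
  (slacks x x′ g C b D e)
  where
  slacks : ∀ x x′ g C b D e →
           (D + e - g) + C ≡ (x′ + (b + e)) + ((x - (x′ + g)) + ((C - x) + (D - b)))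
  slacks = solve-∀ ℚ-ring

p+q≤r+s∧s≤q⇒p≤r : ∀ {p q r s} → p + q ≤ r + s → s ≤ q → p ≤ r
p+q≤r+s∧s≤q⇒p≤r {p} {q} {r} {s} p+q≤r+s s≤q = ≤-from-slack _
  (+-mono-≤ (p≤q⇒0≤q-p p+q≤r+s) (p≤q⇒0≤q-p s≤q)) (slacks p q r s)
  where slacks : ∀ p q r s → r ≡ p + ((r + s - (p + q)) + (q - s))
        slacks = solve-∀ ℚ-ring

amortized-slot : ∀ {V g V′ α W D f} → V ≡ g + V′ → V′ ≤ α * W + (D + α * f - g) →
                 V ≤ α * (f + W) + D
amortized-slot {V} {g} {V′} {α} {W} {D} {f} refl V′≤ =
  ≤-trans (+-monoʳ-≤ g V′≤) (≤-reflexive (regroup g α W D f))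
  where regroup : ∀ g α W D f → g + (α * W + (D + α * f - g)) ≡ α * (f + W) + D
        regroup = solve-∀ ℚ-ring

online≢offline : ∀ {R n} → online R ≢ offline n
online≢offline ()

offline-injective : ∀ {n n′} → offline n ≡ offline n′ → n ≡ n′
offline-injective refl = refl

tick-offline : ∀ {c w n} → tick c w ≡ offline n → w ≡ offline (suc n)
tick-offline {w = offline (suc o)} refl = refl

tick-online : ∀ {c w R} → tick c w ≡ online R → w ≡ online R ⊎ (w ≡ offline 0 × R ≡ c)
tick-online {w = online R}     refl = inj₁ refl
tick-online {w = offline zero} refl = inj₂ (refl , refl)

-- c stands for cap C k; keeping it a parameter stops the normaliser from
-- unfolding the closed form of C ÷₀ k.
module OptPotential (C c : ℚ) (k F′ : ℕ) (cap≡c : cap C k ≡ c) (0≤c : 0ℚ ≤ c) where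

  F : ℕ
  F = suc F′

  WithinCapacity : Wallet → Set
  WithinCapacity (online R)  = 0ℚ ≤ R × R ≤ c
  WithinCapacity (offline _) = ⊤

  Bounded : ∀ {j} → Vec Wallet j → Set
  Bounded ws = ∀ i → WithinCapacity (lookup ws i)

  avail : ℕ → Wallet → ℚ
  avail n       (online R)        = R
  avail zero    (offline _)       = 0ℚ
  avail (suc n) (offline zero)    = c
  avail (suc n) (offline (suc o)) = avail n (offline o)

  Φ : ∀ {j} → ℕ → Vec Wallet j → ℚ
  Φ n []       = 0ℚ
  Φ n (w ∷ ws) = avail n w + Φ n ws

  avail-nonNeg : ∀ n w → WithinCapacity w → 0ℚ ≤ avail n w
  avail-nonNeg n       (online R)        (0≤R , _) = 0≤R
  avail-nonNeg zero    (offline _)       _         = ≤-refl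
  avail-nonNeg (suc n) (offline zero)    _         = 0≤c
  avail-nonNeg (suc n) (offline (suc o)) _         = avail-nonNeg n (offline o) _

  avail-≤-c : ∀ n w → WithinCapacity w → avail n w ≤ c
  avail-≤-c n       (online R)        (_ , R≤c) = R≤c
  avail-≤-c zero    (offline _)       _         = 0≤c
  avail-≤-c (suc n) (offline zero)    _         = ≤-refl
  avail-≤-c (suc n) (offline (suc o)) _         = avail-≤-c n (offline o) _

  Bounded-tail : ∀ {j} {w} {ws : Vec Wallet j} → Bounded (w ∷ ws) → Bounded ws
  Bounded-tail bws i = bws (suc i)

  Φ-nonNeg : ∀ {j} n (ws : Vec Wallet j) → Bounded ws → 0ℚ ≤ Φ n ws
  Φ-nonNeg n []       _   = ≤-refl
  Φ-nonNeg n (w ∷ ws) bws = +-mono-≤ (avail-nonNeg n w (bws zero)) (Φ-nonNeg n ws (Bounded-tail bws))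

  Φ-≤ : ∀ {j} n (ws : Vec Wallet j) → Bounded ws → Φ n ws ≤ ℕ→ℚ j * c
  Φ-≤ n []       _   = ≤-reflexive (sym (*-zeroˡ c))
  Φ-≤ {suc j} n (w ∷ ws) bws = subst (Φ n (w ∷ ws) ≤_) (sym (ℕ→ℚ-suc-* j c))
    (+-mono-≤ (avail-≤-c n w (bws zero)) (Φ-≤ n ws (Bounded-tail bws)))

  Φ-spend : ∀ {j} n (ws : Vec Wallet j) i {R} v → lookup ws i ≡ online R →
            Φ n (ws [ i ]≔ online (R - v)) + v ≡ Φ n ws
  Φ-spend n (online R ∷ ws) zero v refl = spend R (Φ n ws) v
    where spend : ∀ R s v → R - v + s + v ≡ R + s
          spend = solve-∀ ℚ-ring
  Φ-spend n (w ∷ ws) (suc i) {R} v eq = begin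
    avail n w + Φ n (ws [ i ]≔ online (R - v)) + v    ≡⟨ +-assoc (avail n w) _ v ⟩
    avail n w + (Φ n (ws [ i ]≔ online (R - v)) + v)  ≡⟨ cong (avail n w +_) (Φ-spend n ws i v eq) ⟩
    avail n w + Φ n ws                                ∎
    where open ≡-Reasoning

  -- A wallet flushed now is offline for F′ more slots after the tick,
  -- so it is invisible at every horizon n ≤ F′.
  avail-tick : ∀ n b w → n ℕ.≤ F′ → WithinCapacity w →
               avail n (tick c (flushW F b w)) ≤ avail (suc n) w
  avail-tick n true (online R) n≤F′ (0≤R , _) = subst (_≤ R) (sym (invisible n F′ n≤F′)) 0≤R
    where invisible : ∀ n o → n ℕ.≤ o → avail n (offline o) ≡ 0ℚ
          invisible zero    o       _           = refl
          invisible (suc n) (suc o) (ℕ.s≤s n≤o) = invisible n o n≤o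
  avail-tick n true  (offline zero)    _ _ = ≤-refl
  avail-tick n true  (offline (suc o)) _ _ = ≤-refl
  avail-tick n false (online R)        _ _ = ≤-refl
  avail-tick n false (offline zero)    _ _ = ≤-refl
  avail-tick n false (offline (suc o)) _ _ = ≤-refl

  Φ-endSlot : ∀ {j} n (fl : Vec Bool j) (ws : Vec Wallet j) → n ℕ.≤ F′ → Bounded ws →
              Φ n (endSlot c F fl ws) ≤ Φ (suc n) ws
  Φ-endSlot n []       []       _    _   = ≤-refl
  Φ-endSlot n (b ∷ fl) (w ∷ ws) n≤F′ bws =
    +-mono-≤ (avail-tick n b w n≤F′ (bws zero)) (Φ-endSlot n fl ws n≤F′ (Bounded-tail bws))

  lookup-endSlot : ∀ {j} (fl : Vec Bool j) ws i →
                   lookup (endSlot c F fl ws) i ≡ tick c (flushW F (lookup fl i) (lookup ws i))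
  lookup-endSlot fl ws i =
    trans (Vec.lookup-map i (tick c) (zipWith (flushW F) fl ws))
          (cong (tick c) (Vec.lookup-zipWith (flushW F) i fl ws))

  within-tick : ∀ b w → WithinCapacity w → WithinCapacity (tick c (flushW F b w))
  within-tick true  (online R)        _   = _
  within-tick true  (offline zero)    _   = 0≤c , ≤-refl
  within-tick true  (offline (suc o)) _   = _
  within-tick false (online R)        R-ok = R-ok
  within-tick false (offline zero)    _   = 0≤c , ≤-refl
  within-tick false (offline (suc o)) _   = _

  Bounded-endSlot : ∀ {j} (fl : Vec Bool j) ws → Bounded ws → Bounded (endSlot c F fl ws)
  Bounded-endSlot fl ws bws i =
    subst WithinCapacity (sym (lookup-endSlot fl ws i)) (within-tick (lookup fl i) (lookup ws i) (bws i))

  Bounded-update : ∀ {j} (ws : Vec Wallet j) i w → Bounded ws → WithinCapacity w → Bounded (ws [ i ]≔ w)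
  Bounded-update ws i w bws w-ok x with i Fin.≟ x
  ... | yes refl = subst WithinCapacity (sym (Vec.lookup∘update i ws w)) w-ok
  ... | no i≢x   = subst WithinCapacity (sym (Vec.lookup∘update′ (≢-sym i≢x) ws w)) (bws x)

  Φ-Step : Wallets k → ℚ → Wallets k → Set
  Φ-Step ws g ws′ = ∀ n → n ℕ.≤ F′ → Φ n ws′ + g ≤ Φ (suc n) ws

  record OptSlot (P : Policy k) (t : ℕ) (ws : Wallets k) (v : ℚ) (tx : List ℚ) (V : ℚ) : Set where
    field
      gain     : ℚ
      wallets′ : Wallets k
      rest     : ℚ
      run-rest : runPolicy C k F P (suc t) wallets′ tx ≡ just rest
      value    : V ≡ gain + rest
      gain≤v   : gain ≤ v
      bounded  : Bounded wallets′
      Φ-step   : Φ-Step ws gain wallets′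
      gain≤Φ   : gain ≤ Φ 0 ws

  opt-slot : ∀ P t ws v tx V → 0ℚ ≤ v → Bounded ws →
             runPolicy C k F P t ws (v ∷ tx) ≡ just V → OptSlot P t ws v tx V
  opt-slot P t ws v tx V 0≤v bws run with Decision.settle (P t)
  ... | nothing = record
    { gain = 0ℚ ; wallets′ = endSlot c F fl ws ; rest = V
    ; run-rest = subst (λ c → runPolicy C k F P (suc t) (endSlot c F fl ws) tx ≡ just V) cap≡c run
    ; value = sym (+-identityˡ V) ; gain≤v = 0≤v ; bounded = Bounded-endSlot fl ws bws
    ; Φ-step = λ n n≤F′ → subst (_≤ Φ (suc n) ws) (sym (+-identityʳ _)) (Φ-endSlot n fl ws n≤F′ bws)
    ; gain≤Φ = Φ-nonNeg 0 ws bws }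
    where fl : Vec Bool k
          fl = Decision.flush (P t)
  ... | just i with lookup ws i in ws[i]≡
  ...   | offline _ with () ← run
  ...   | online R with v ≤? R
  ...     | no _ with () ← run
  ...     | yes v≤R with runPolicy C k F P (suc t)
                             (endSlot (cap C k) F (Decision.flush (P t)) (ws [ i ]≔ online (R - v))) tx in run-rest
  ...       | nothing with () ← run
  ...       | just V′ = record
    { gain = v ; wallets′ = endSlot c F fl ws₁ ; rest = V′
    ; run-rest = subst (λ c → runPolicy C k F P (suc t) (endSlot c F fl ws₁) tx ≡ just V′) cap≡c run-rest
    ; value = sym (just-injective run) ; gain≤v = ≤-refl ; bounded = Bounded-endSlot fl ws₁ bws₁
    ; Φ-step = λ n n≤F′ → ≤-trans (+-monoˡ-≤ v (Φ-endSlot n fl ws₁ n≤F′ bws₁))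
                                  (≤-reflexive (Φ-spend (suc n) ws i v ws[i]≡))
    ; gain≤Φ = ≤-from-slack (Φ 0 ws₁) (Φ-nonNeg 0 ws₁ bws₁)
                 (trans (sym (Φ-spend 0 ws i v ws[i]≡)) (+-comm (Φ 0 ws₁) v)) }
    where
    fl : Vec Bool k
    fl = Decision.flush (P t)
    ws₁ : Wallets k
    ws₁ = ws [ i ]≔ online (R - v)
    R-v≤c : R - v ≤ c
    R-v≤c = ≤-trans (p-q≤p R 0≤v) (proj₂ (subst WithinCapacity ws[i]≡ (bws i)))
    bws₁ : Bounded ws₁
    bws₁ = Bounded-update ws i _ bws (p≤q⇒0≤q-p v≤R , R-v≤c)

module FlushWhenFullAnalysis
  (C c T α : ℚ) (m′ F′ : ℕ)
  (cap≡c : cap C (suc (suc m′)) ≡ c)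
  (0≤T : 0ℚ ≤ T)
  (T<c : T < c)
  (cycle-pays : C + (c - T) ≤ α * (ℕ→ℚ (suc (suc m′)) * (c - T)))
  where

  k m : ℕ
  k = suc (suc m′)
  m = suc m′

  open OptPotential C c k F′ cap≡c (≤-trans 0≤T (<⇒≤ T<c))

  K B β : ℚ
  K = ℕ→ℚ k
  B = c - T
  β = (α - 1ℚ) * B

  K*c≡C : K * c ≡ C
  K*c≡C = trans (cong (K *_) (sym cap≡c)) (ℕ→ℚ-*-cap C m)

  0<B : 0ℚ < B
  0<B = subst (_< B) (+-inverseʳ T) (+-monoˡ-< (- T) T<c)

  Φ-≤-C : ∀ n (ws : Wallets k) → Bounded ws → Φ n ws ≤ C
  Φ-≤-C n ws bws = subst (Φ n ws ≤_) K*c≡C (Φ-≤ n ws bws)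

  1≤α : 1ℚ ≤ α
  1≤α = <⇒≤ (*-cancelʳ-<-nonNeg (K * B) {{nonNegative 0≤KB}} (begin-strict
    1ℚ * (K * B)    ≡⟨ *-identityˡ (K * B) ⟩
    K * B           <⟨ subst (_< K * B + B) (+-identityʳ (K * B)) (+-monoʳ-< (K * B) 0<B) ⟩
    K * B + B       ≤⟨ +-monoˡ-≤ B K*B≤C ⟩
    C + B           ≤⟨ cycle-pays ⟩
    α * (K * B)     ∎))
    where
    open ≤-Reasoning
    0≤K : 0ℚ ≤ K
    0≤K = <⇒≤ (ℕ→ℚ-pos m)
    0≤KB : 0ℚ ≤ K * B
    0≤KB = *-nonNeg 0≤K (<⇒≤ 0<B)
    K*B≤C : K * B ≤ C
    K*B≤C = subst (K * B ≤_) K*c≡C (*-monoˡ-≤-nonNeg K {{nonNegative 0≤K}} (p-q≤p c 0≤T))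

  0≤α-1 : 0ℚ ≤ α - 1ℚ
  0≤α-1 = p≤q⇒0≤q-p 1≤α

  0≤α : 0ℚ ≤ α
  0≤α = ≤-trans (nonNegative⁻¹ 1ℚ) 1≤α

  reserve : ℕ → ℚ → ℚ
  reserve j u = β + α * (ℕ→ℚ j * B + u)

  reserve-zero : ∀ f → reserve 0 f ≡ β + α * f
  reserve-zero f = drop-0 β α B f
    where drop-0 : ∀ β α B f → β + α * (0ℚ * B + f) ≡ β + α * f
          drop-0 = solve-∀ ℚ-ring

  reserve-spend : ∀ j u f → reserve j (u + f) ≡ reserve j u + α * f
  reserve-spend j u f = distrib β α (ℕ→ℚ j * B) u f
    where distrib : ∀ β α x u f → β + α * (x + (u + f)) ≡ β + α * (x + u) + α * f
          distrib = solve-∀ ℚ-ring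

  reserve-advance : ∀ j {u} f → B ≤ u → reserve (suc j) f ≤ reserve j u + α * f
  reserve-advance j {u} f B≤u = ≤-from-slack (α * (u - B))
    (*-nonNeg 0≤α (p≤q⇒0≤q-p B≤u))
    (trans (slacks β α B (ℕ→ℚ j * B) u f)
           (cong (λ x → β + α * (x + f) + α * (u - B)) (sym (ℕ→ℚ-suc-* j B))))
    where slacks : ∀ β α B x u f → β + α * (x + u) + α * f ≡ β + α * (B + x + f) + α * (u - B)
          slacks = solve-∀ ℚ-ring

  x+α*0≡x : ∀ x → x + α * 0ℚ ≡ x
  x+α*0≡x x = drop-0 x α
    where drop-0 : ∀ x α → x + α * 0ℚ ≡ x
          drop-0 = solve-∀ ℚ-ring

  reserve-advance₀ : ∀ j {u} → B ≤ u → reserve (suc j) 0ℚ ≤ reserve j u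
  reserve-advance₀ j B≤u = subst (reserve (suc j) 0ℚ ≤_) (x+α*0≡x _) (reserve-advance j 0ℚ B≤u)

  C≤reserve : C ≤ reserve m 0ℚ
  C≤reserve = ≤-from-slack _ (p≤q⇒0≤q-p cycle-pays) (begin
    reserve m 0ℚ                  ≡⟨ collect β α B (ℕ→ℚ m * B) ⟩
    α * (B + ℕ→ℚ m * B) - B       ≡⟨ cong (λ x → α * x - B) (ℕ→ℚ-suc-* m B) ⟨
    α * (K * B) - B               ≡⟨ slacks C B (α * (K * B)) ⟩
    C + (α * (K * B) - (C + B))   ∎)
    where
    open ≡-Reasoning
    collect : ∀ β α B x → (α - 1ℚ) * B + α * (x + 0ℚ) ≡ α * (B + x) - B
    collect = solve-∀ ℚ-ring
    slacks : ∀ C B y → y - B ≡ C + (y - (C + B))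
    slacks = solve-∀ ℚ-ring

  spent : Wallet → ℚ
  spent (online R)  = c - R
  spent (offline _) = 0ℚ

  spent-tick-offline : ∀ n → spent (tick c (offline n)) ≡ 0ℚ
  spent-tick-offline zero    = +-inverseʳ c
  spent-tick-offline (suc n) = refl

  B≤spent : ∀ {R v} → R < v → v ≤ T → B ≤ c - R
  B≤spent {R} {v} R<v v≤T = ≤-from-slack (T - R) (p≤q⇒0≤q-p (≤-trans (<⇒≤ R<v) v≤T)) (split c T R)
    where split : ∀ c T R → c - R ≡ c - T + (T - R)
          split = solve-∀ ℚ-ring

  lookup-noFlush : ∀ (ws : Wallets k) i → lookup (endSlot c F noFlush ws) i ≡ tick c (lookup ws i)
  lookup-noFlush ws i = trans (lookup-endSlot noFlush ws i)
    (cong (λ b → tick c (flushW F b (lookup ws i))) (Vec.lookup-replicate i false))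

  lookup-flushed : ∀ (ws : Wallets k) a →
                   lookup (endSlot c F (noFlush [ a ]≔ true) ws) a ≡ tick c (flushW F true (lookup ws a))
  lookup-flushed ws a = trans (lookup-endSlot (noFlush [ a ]≔ true) ws a)
    (cong (λ b → tick c (flushW F b (lookup ws a))) (Vec.lookup∘update a noFlush true))

  lookup-unflushed : ∀ (ws : Wallets k) {a i} → a ≢ i →
                     lookup (endSlot c F (noFlush [ a ]≔ true) ws) i ≡ tick c (lookup ws i)
  lookup-unflushed ws {a} {i} a≢i = trans (lookup-endSlot (noFlush [ a ]≔ true) ws i)
    (cong (λ b → tick c (flushW F b (lookup ws i)))
          (trans (Vec.lookup∘update′ (≢-sym a≢i) noFlush true) (Vec.lookup-replicate i false)))

  -- a is FWF's active wallet, fws and ows are the wallets of FWF and OPT,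
  -- and D is the credit.
  record Invariant (a : Fin k) (fws ows : Wallets k) (D : ℚ) : Set where
    field
      active       : ∀ R → lookup fws a ≡ online R → R ≤ c × (α - 1ℚ) * (c - R) ≤ D
      others-full  : ∀ i R → i ≢ a → lookup fws i ≡ online R → R ≡ c
      offline-≤F′  : ∀ i n → lookup fws i ≡ offline n → n ℕ.≤ F′
      offline-paid : ∀ d → d ℕ.≤ m → ∀ n → lookup fws (next^ d a) ≡ offline n →
                     Φ n ows + reserve (m ∸ d) (spent (lookup fws a)) ≤ D + C

  module _ {a fws ows D} (inv : Invariant a fws ows D) where
    open Invariant inv

    paid-Φ : ∀ {d n} → d ℕ.≤ m → lookup fws (next^ d a) ≡ offline n →
             C ≤ reserve (m ∸ d) (spent (lookup fws a)) → Φ n ows ≤ D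
    paid-Φ {d} {n} d≤m away C≤ = p+q≤r+s∧s≤q⇒p≤r (offline-paid d d≤m n away) C≤

    credit-nonNeg : Bounded ows → 0ℚ ≤ D
    credit-nonNeg bows with lookup fws a in fws[a]≡
    ... | online R  = ≤-trans (*-nonNeg 0≤α-1 (p≤q⇒0≤q-p (proj₁ (active R fws[a]≡))))
                              (proj₂ (active R fws[a]≡))
    ... | offline n = ≤-trans (Φ-nonNeg n ows bows) (paid-Φ ℕ.z≤n fws[a]≡
                        (subst (λ w → C ≤ reserve m (spent w)) (sym fws[a]≡) C≤reserve))

    β≤credit : ∀ {R v} → lookup fws a ≡ online R → R < v → v ≤ T → β ≤ D
    β≤credit fws[a]≡ R<v v≤T = ≤-trans
      (*-monoˡ-≤-nonNeg (α - 1ℚ) {{nonNegative 0≤α-1}} (B≤spent R<v v≤T))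
      (proj₂ (active _ fws[a]≡))

    ticked-full : ∀ {i R} → i ≢ a → tick c (lookup fws i) ≡ online R → R ≡ c
    ticked-full i≢a ticked with tick-online ticked
    ... | inj₁ was-online = others-full _ _ i≢a was-online
    ... | inj₂ (_ , R≡c)  = R≡c

    ticked-≤F′ : ∀ {i n} → tick c (lookup fws i) ≡ offline n → n ℕ.≤ F′
    ticked-≤F′ {i} {n} ticked =
      ℕ.≤-trans (ℕ.n≤1+n n) (offline-≤F′ i (suc n) (tick-offline ticked))

    ticked-paid : ∀ {d n g ows′ K′ f} → d ℕ.≤ m → tick c (lookup fws (next^ d a)) ≡ offline n →
                  Φ-Step ows g ows′ → K′ ≤ reserve (m ∸ d) (spent (lookup fws a)) + α * f →
                  Φ n ows′ + K′ ≤ (D + α * f - g) + C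
    ticked-paid {d} {n} {ows′ = ows′} d≤m ticked step K′≤ =
      credit-shift {x′ = Φ n ows′} {D = D} {C = C}
        (step n (ticked-≤F′ ticked)) (offline-paid d d≤m (suc n) (tick-offline ticked)) K′≤

  flushed-paid : ∀ {ows ows′ g D} f → Φ-Step ows g ows′ → Bounded ows → β ≤ D →
                 Φ F′ ows′ + reserve (m ∸ m) f ≤ (D + α * f - g) + C
  flushed-paid {ows} {ows′} {g} {D} f step bows β≤D =
    subst (λ x → Φ F′ ows′ + x ≤ (D + α * f - g) + C)
          (sym (trans (cong (λ j → reserve j f) (ℕ.n∸n≡0 m)) (reserve-zero f)))
          (fresh-credit {x′ = Φ F′ ows′} {D = D} (step F′ ℕ.≤-refl) (Φ-≤-C F ows bows) β≤D)

  returns-full-credit : ∀ {g D} → g ≤ D → (α - 1ℚ) * (c - c) ≤ D + α * 0ℚ - g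
  returns-full-credit {g} {D} g≤D = ≤-from-slack (D - g) (p≤q⇒0≤q-p g≤D) (slacks α c D g)
    where slacks : ∀ α c D g → D + α * 0ℚ - g ≡ (α - 1ℚ) * (c - c) + (D - g)
          slacks = solve-∀ ℚ-ring

  settle-credit : ∀ {R v g D} → (α - 1ℚ) * (c - R) ≤ D → g ≤ v →
                  (α - 1ℚ) * (c - (R - v)) ≤ D + α * v - g
  settle-credit {R} {v} {g} {D} old g≤v = ≤-from-slack _
    (+-mono-≤ (p≤q⇒0≤q-p old) (p≤q⇒0≤q-p g≤v)) (slacks α c R v g D)
    where slacks : ∀ α c R v g D → D + α * v - g ≡
                     (α - 1ℚ) * (c - (R - v)) + ((D - (α - 1ℚ) * (c - R)) + (v - g))
          slacks = solve-∀ ℚ-ring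

  switch-credit : ∀ {v g D} → 0ℚ ≤ D → g ≤ v → (α - 1ℚ) * (c - (c - v)) ≤ D + α * v - g
  switch-credit {v} {g} {D} 0≤D g≤v = ≤-from-slack _
    (+-mono-≤ 0≤D (p≤q⇒0≤q-p g≤v)) (slacks α c v g D)
    where slacks : ∀ α c v g D → D + α * v - g ≡ (α - 1ℚ) * (c - (c - v)) + (D + (v - g))
          slacks = solve-∀ ℚ-ring

  invariant-wait : ∀ {a fws ows D n₀ P t v tx V} → lookup fws a ≡ offline n₀ →
                   Invariant a fws ows D → (os : OptSlot P t ows v tx V) →
                   Invariant a (endSlot c F noFlush fws) (OptSlot.wallets′ os)
                             (D + α * 0ℚ - OptSlot.gain os)
  invariant-wait {a} {fws} {ows} {D} {n₀} fws[a]≡ inv os = record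
    { active = new-active ; others-full = new-others-full
    ; offline-≤F′ = new-offline-≤F′ ; offline-paid = new-offline-paid }
    where
    open Invariant inv
    open OptSlot os
    fws′ : Wallets k
    fws′ = endSlot c F noFlush fws

    at-a : lookup fws′ a ≡ tick c (offline n₀)
    at-a = trans (lookup-noFlush fws a) (cong (tick c) fws[a]≡)

    new-active : ∀ R → lookup fws′ a ≡ online R →
                 R ≤ c × (α - 1ℚ) * (c - R) ≤ D + α * 0ℚ - gain
    new-active R back with tick-online (trans (sym at-a) back)
    ... | inj₂ (was-0 , R≡c) =
      ≤-reflexive R≡c ,
      subst (λ R → (α - 1ℚ) * (c - R) ≤ D + α * 0ℚ - gain) (sym R≡c) (returns-full-credit g≤D)
      where g≤D : gain ≤ D
            g≤D = ≤-trans gain≤Φ (paid-Φ inv ℕ.z≤n (trans fws[a]≡ was-0)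
                    (subst (λ w → C ≤ reserve m (spent w)) (sym fws[a]≡) C≤reserve))

    new-others-full : ∀ i R → i ≢ a → lookup fws′ i ≡ online R → R ≡ c
    new-others-full i R i≢a now = ticked-full inv i≢a (trans (sym (lookup-noFlush fws i)) now)

    new-offline-≤F′ : ∀ i n → lookup fws′ i ≡ offline n → n ℕ.≤ F′
    new-offline-≤F′ i n away = ticked-≤F′ inv (trans (sym (lookup-noFlush fws i)) away)

    new-offline-paid : ∀ d → d ℕ.≤ m → ∀ n → lookup fws′ (next^ d a) ≡ offline n →
                       Φ n wallets′ + reserve (m ∸ d) (spent (lookup fws′ a)) ≤ (D + α * 0ℚ - gain) + C
    new-offline-paid d d≤m n away =
      ticked-paid inv {ows′ = wallets′} d≤m (trans (sym (lookup-noFlush fws (next^ d a))) away) Φ-step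
        (≤-reflexive (trans (cong (reserve (m ∸ d)) spent-unchanged) (sym (x+α*0≡x _))))
      where spent-unchanged : spent (lookup fws′ a) ≡ spent (lookup fws a)
            spent-unchanged = trans (cong spent at-a)
                                (trans (spent-tick-offline n₀) (cong spent (sym fws[a]≡)))

  invariant-settle : ∀ {a fws ows D R P t v tx V} → lookup fws a ≡ online R → v ≤ R → 0ℚ ≤ v →
                     Invariant a fws ows D → (os : OptSlot P t ows v tx V) →
                     Invariant a (endSlot c F noFlush (fws [ a ]≔ online (R - v))) (OptSlot.wallets′ os)
                               (D + α * v - OptSlot.gain os)
  invariant-settle {a} {fws} {ows} {D} {R} {v = v} fws[a]≡ v≤R 0≤v inv os = record
    { active = new-active ; others-full = new-others-full
    ; offline-≤F′ = new-offline-≤F′ ; offline-paid = new-offline-paid }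
    where
    open Invariant inv
    open OptSlot os
    fws₁ fws′ : Wallets k
    fws₁ = fws [ a ]≔ online (R - v)
    fws′ = endSlot c F noFlush fws₁

    at-a : lookup fws′ a ≡ online (R - v)
    at-a = trans (lookup-noFlush fws₁ a) (cong (tick c) (Vec.lookup∘update a fws (online (R - v))))

    elsewhere : ∀ {i} → a ≢ i → lookup fws′ i ≡ tick c (lookup fws i)
    elsewhere {i} a≢i =
      trans (lookup-noFlush fws₁ i) (cong (tick c) (Vec.lookup∘update′ (≢-sym a≢i) fws _))

    new-active : ∀ R′ → lookup fws′ a ≡ online R′ →
                 R′ ≤ c × (α - 1ℚ) * (c - R′) ≤ D + α * v - gain
    new-active R′ now with trans (sym at-a) now
    ... | refl = ≤-trans (p-q≤p R 0≤v) (proj₁ (active R fws[a]≡)) ,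
                 settle-credit (proj₂ (active R fws[a]≡)) gain≤v

    new-others-full : ∀ i R′ → i ≢ a → lookup fws′ i ≡ online R′ → R′ ≡ c
    new-others-full i R′ i≢a now = ticked-full inv i≢a (trans (sym (elsewhere (≢-sym i≢a))) now)

    new-offline-≤F′ : ∀ i n → lookup fws′ i ≡ offline n → n ℕ.≤ F′
    new-offline-≤F′ i n away with a Fin.≟ i
    ... | yes refl = contradiction (trans (sym at-a) away) online≢offline
    ... | no a≢i   = ticked-≤F′ inv (trans (sym (elsewhere a≢i)) away)

    new-offline-paid : ∀ d → d ℕ.≤ m → ∀ n → lookup fws′ (next^ d a) ≡ offline n →
                       Φ n wallets′ + reserve (m ∸ d) (spent (lookup fws′ a)) ≤ (D + α * v - gain) + C
    new-offline-paid d d≤m n away with a Fin.≟ next^ d a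
    ... | yes a≡p = contradiction (trans (sym at-a) (trans (cong (lookup fws′) a≡p) away)) online≢offline
    ... | no a≢p  = ticked-paid inv {ows′ = wallets′} d≤m (trans (sym (elsewhere a≢p)) away) Φ-step
                      (≤-reflexive (trans (cong (reserve (m ∸ d)) spent-more) (reserve-spend (m ∸ d) _ v)))
      where
      spent-more : spent (lookup fws′ a) ≡ spent (lookup fws a) + v
      spent-more = trans (cong spent at-a) (trans (split c R v) (cong (λ w → spent w + v) (sym fws[a]≡)))
        where split : ∀ c R v → c - (R - v) ≡ c - R + v
              split = solve-∀ ℚ-ring

  invariant-switch-settle : ∀ {a fws ows D R R′ P t v tx V} →
                            lookup fws a ≡ online R → R < v → v ≤ T →
                            lookup fws (next a) ≡ online R′ → v ≤ R′ → 0ℚ ≤ v → Bounded ows →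
                            Invariant a fws ows D → (os : OptSlot P t ows v tx V) →
                            Invariant (next a)
                                      (endSlot c F (noFlush [ a ]≔ true) (fws [ next a ]≔ online (R′ - v)))
                                      (OptSlot.wallets′ os) (D + α * v - OptSlot.gain os)
  invariant-switch-settle {a} {fws} {ows} {D} {R} {R′} {v = v}
                          fws[a]≡ R<v v≤T fws[a′]≡ v≤R′ 0≤v bows inv os = record
    { active = new-active ; others-full = new-others-full
    ; offline-≤F′ = new-offline-≤F′ ; offline-paid = new-offline-paid }
    where
    open Invariant inv
    open OptSlot os
    a′ : Fin k
    a′ = next a
    a≢a′ : a ≢ a′
    a≢a′ = ≢-sym (next≢ a)
    R′≡c : R′ ≡ c
    R′≡c = others-full a′ R′ (next≢ a) fws[a′]≡
    fws₁ fws′ : Wallets k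
    fws₁ = fws [ a′ ]≔ online (R′ - v)
    fws′ = endSlot c F (noFlush [ a ]≔ true) fws₁

    at-a : lookup fws′ a ≡ offline F′
    at-a = trans (lookup-flushed fws₁ a)
      (cong (λ w → tick c (flushW F true w)) (trans (Vec.lookup∘update′ a≢a′ fws _) fws[a]≡))

    at-a′ : lookup fws′ a′ ≡ online (R′ - v)
    at-a′ = trans (lookup-unflushed fws₁ a≢a′) (cong (tick c) (Vec.lookup∘update a′ fws _))

    elsewhere : ∀ {i} → a ≢ i → a′ ≢ i → lookup fws′ i ≡ tick c (lookup fws i)
    elsewhere {i} a≢i a′≢i =
      trans (lookup-unflushed fws₁ a≢i) (cong (tick c) (Vec.lookup∘update′ (≢-sym a′≢i) fws _))

    spent-a′ : spent (lookup fws′ a′) ≡ v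
    spent-a′ = trans (cong spent at-a′) (trans (cong (λ x → c - (x - v)) R′≡c) (cancel c v))
      where cancel : ∀ c v → c - (c - v) ≡ v
            cancel = solve-∀ ℚ-ring

    new-active : ∀ R″ → lookup fws′ a′ ≡ online R″ →
                 R″ ≤ c × (α - 1ℚ) * (c - R″) ≤ D + α * v - gain
    new-active R″ now with trans (sym at-a′) now
    ... | refl = subst (λ x → x - v ≤ c × (α - 1ℚ) * (c - (x - v)) ≤ D + α * v - gain) (sym R′≡c)
                   (p-q≤p c 0≤v , switch-credit (credit-nonNeg inv bows) gain≤v)

    new-others-full : ∀ i R″ → i ≢ a′ → lookup fws′ i ≡ online R″ → R″ ≡ c
    new-others-full i R″ i≢a′ now with a Fin.≟ i
    ... | yes refl = contradiction (trans (sym now) at-a) online≢offline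
    ... | no a≢i   = ticked-full inv (≢-sym a≢i) (trans (sym (elsewhere a≢i (≢-sym i≢a′))) now)

    new-offline-≤F′ : ∀ i n → lookup fws′ i ≡ offline n → n ℕ.≤ F′
    new-offline-≤F′ i n away with a Fin.≟ i | a′ Fin.≟ i
    ... | yes refl | _        = ℕ.≤-reflexive (offline-injective (trans (sym away) at-a))
    ... | no _     | yes refl = contradiction (trans (sym at-a′) away) online≢offline
    ... | no a≢i   | no a′≢i  = ticked-≤F′ inv (trans (sym (elsewhere a≢i a′≢i)) away)

    new-offline-paid : ∀ d → d ℕ.≤ m → ∀ n → lookup fws′ (next^ d a′) ≡ offline n →
                       Φ n wallets′ + reserve (m ∸ d) (spent (lookup fws′ a′)) ≤ (D + α * v - gain) + C
    new-offline-paid d d≤m n away with a Fin.≟ next^ d a′ | a′ Fin.≟ next^ d a′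
    ... | yes a≡p | _ with next^-return d a d≤m (sym a≡p)
                         | offline-injective (trans (sym away) (trans (cong (lookup fws′) (sym a≡p)) at-a))
    ...   | refl | refl =
      subst (λ u → Φ F′ wallets′ + reserve (m ∸ m) u ≤ (D + α * v - gain) + C) (sym spent-a′)
            (flushed-paid {ows} {wallets′} v Φ-step bows (β≤credit inv fws[a]≡ R<v v≤T))
    new-offline-paid d d≤m n away | no _ | yes a′≡p =
      contradiction (trans (sym at-a′) (trans (cong (lookup fws′) a′≡p) away)) online≢offline
    new-offline-paid d d≤m n away | no a≢p | no a′≢p =
      ticked-paid inv {ows′ = wallets′} sd≤m (trans (sym (elsewhere a≢p a′≢p)) away) Φ-step
        (subst₂ (λ j u → reserve j u ≤ reserve (m ∸ suc d) (spent (lookup fws a)) + α * v)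
                (sym (ℕ.+-∸-assoc 1 sd≤m)) (sym spent-a′)
                (subst (λ w → reserve (suc (m ∸ suc d)) v ≤ reserve (m ∸ suc d) (spent w) + α * v)
                       (sym fws[a]≡) (reserve-advance (m ∸ suc d) v (B≤spent R<v v≤T))))
      where sd≤m : suc d ℕ.≤ m
            sd≤m = next^-no-return d a d≤m (≢-sym a≢p)

  invariant-switch-wait : ∀ {a fws ows D R n₁ P t v tx V} →
                          lookup fws a ≡ online R → R < v → v ≤ T →
                          lookup fws (next a) ≡ offline n₁ → Bounded ows →
                          Invariant a fws ows D → (os : OptSlot P t ows v tx V) →
                          Invariant (next a) (endSlot c F (noFlush [ a ]≔ true) fws)
                                    (OptSlot.wallets′ os) (D + α * 0ℚ - OptSlot.gain os)
  invariant-switch-wait {a} {fws} {ows} {D} {R} {n₁} {v = v} fws[a]≡ R<v v≤T fws[a′]≡ bows inv os = record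
    { active = new-active ; others-full = new-others-full
    ; offline-≤F′ = new-offline-≤F′ ; offline-paid = new-offline-paid }
    where
    open Invariant inv
    open OptSlot os
    a′ : Fin k
    a′ = next a
    a≢a′ : a ≢ a′
    a≢a′ = ≢-sym (next≢ a)
    fws′ : Wallets k
    fws′ = endSlot c F (noFlush [ a ]≔ true) fws

    at-a : lookup fws′ a ≡ offline F′
    at-a = trans (lookup-flushed fws a) (cong (λ w → tick c (flushW F true w)) fws[a]≡)

    at-a′ : lookup fws′ a′ ≡ tick c (offline n₁)
    at-a′ = trans (lookup-unflushed fws a≢a′) (cong (tick c) fws[a′]≡)

    spent-a′ : spent (lookup fws′ a′) ≡ 0ℚ
    spent-a′ = trans (cong spent at-a′) (spent-tick-offline n₁)

    new-active : ∀ R″ → lookup fws′ a′ ≡ online R″ →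
                 R″ ≤ c × (α - 1ℚ) * (c - R″) ≤ D + α * 0ℚ - gain
    new-active R″ back with tick-online (trans (sym at-a′) back)
    ... | inj₂ (was-0 , R″≡c) =
      ≤-reflexive R″≡c ,
      subst (λ R → (α - 1ℚ) * (c - R) ≤ D + α * 0ℚ - gain) (sym R″≡c) (returns-full-credit g≤D)
      where
      C≤ : C ≤ reserve m′ (spent (lookup fws a))
      C≤ = ≤-trans C≤reserve (subst (λ w → reserve m 0ℚ ≤ reserve m′ (spent w)) (sym fws[a]≡)
                                     (reserve-advance₀ m′ (B≤spent R<v v≤T)))
      g≤D : gain ≤ D
      g≤D = ≤-trans gain≤Φ (paid-Φ inv (ℕ.s≤s ℕ.z≤n) (trans fws[a′]≡ was-0) C≤)

    new-others-full : ∀ i R″ → i ≢ a′ → lookup fws′ i ≡ online R″ → R″ ≡ c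
    new-others-full i R″ i≢a′ now with a Fin.≟ i
    ... | yes refl = contradiction (trans (sym now) at-a) online≢offline
    ... | no a≢i   = ticked-full inv (≢-sym a≢i) (trans (sym (lookup-unflushed fws a≢i)) now)

    new-offline-≤F′ : ∀ i n → lookup fws′ i ≡ offline n → n ℕ.≤ F′
    new-offline-≤F′ i n away with a Fin.≟ i
    ... | yes refl = ℕ.≤-reflexive (offline-injective (trans (sym away) at-a))
    ... | no a≢i   = ticked-≤F′ inv (trans (sym (lookup-unflushed fws a≢i)) away)

    new-offline-paid : ∀ d → d ℕ.≤ m → ∀ n → lookup fws′ (next^ d a′) ≡ offline n →
                       Φ n wallets′ + reserve (m ∸ d) (spent (lookup fws′ a′)) ≤ (D + α * 0ℚ - gain) + C
    new-offline-paid d d≤m n away with a Fin.≟ next^ d a′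
    ... | yes a≡p with next^-return d a d≤m (sym a≡p)
                     | offline-injective (trans (sym away) (trans (cong (lookup fws′) (sym a≡p)) at-a))
    ...   | refl | refl =
      subst (λ u → Φ F′ wallets′ + reserve (m ∸ m) u ≤ (D + α * 0ℚ - gain) + C) (sym spent-a′)
            (flushed-paid {ows} {wallets′} 0ℚ Φ-step bows (β≤credit inv fws[a]≡ R<v v≤T))
    new-offline-paid d d≤m n away | no a≢p =
      ticked-paid inv {ows′ = wallets′} sd≤m (trans (sym (lookup-unflushed fws a≢p)) away) Φ-step
        (subst₂ (λ j u → reserve j u ≤ reserve (m ∸ suc d) (spent (lookup fws a)) + α * 0ℚ)
                (sym (ℕ.+-∸-assoc 1 sd≤m)) (sym spent-a′)
                (subst (λ w → reserve (suc (m ∸ suc d)) 0ℚ ≤ reserve (m ∸ suc d) (spent w) + α * 0ℚ)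
                       (sym fws[a]≡) (reserve-advance (m ∸ suc d) 0ℚ (B≤spent R<v v≤T))))
      where sd≤m : suc d ℕ.≤ m
            sd≤m = next^-no-return d a d≤m (≢-sym a≢p)

  mutual
    opt≤α*fwf+credit : ∀ P tx t a fws ows D V → All (λ v → 0ℚ ≤ v × v ≤ T) tx → Bounded ows →
                       Invariant a fws ows D → runPolicy C k F P t ows tx ≡ just V →
                       V ≤ α * runFWF c F a fws tx + D
    opt≤α*fwf+credit P [] t a fws ows D V [] bows inv refl =
      ≤-trans (credit-nonNeg inv bows) (≤-reflexive (sym (α*0+D α D)))
      where α*0+D : ∀ α D → α * 0ℚ + D ≡ D
            α*0+D = solve-∀ ℚ-ring
    opt≤α*fwf+credit P (v ∷ tx) t a fws ows D V ((0≤v , v≤T) ∷ tx-ok) bows inv run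
      with opt-slot P t ows v tx V 0≤v bows run | lookup fws a in fws[a]≡
    ... | os | offline _ =
      subst (λ x → V ≤ α * x + D) (+-identityˡ _)
            (after-slot tx-ok os (invariant-wait fws[a]≡ inv os))
    ... | os | online R with v ≤? R
    ...   | yes v≤R = after-slot tx-ok os (invariant-settle fws[a]≡ v≤R 0≤v inv os)
    ...   | no v≰R with lookup fws (next a) in fws[a′]≡
    ...     | offline _ =
      subst (λ x → V ≤ α * x + D) (+-identityˡ _)
            (after-slot tx-ok os (invariant-switch-wait fws[a]≡ (≰⇒> v≰R) v≤T fws[a′]≡ bows inv os))
    ...     | online R′ with v ≤? R′
    ...       | yes v≤R′ = after-slot tx-ok os
      (invariant-switch-settle fws[a]≡ (≰⇒> v≰R) v≤T fws[a′]≡ v≤R′ 0≤v bows inv os)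
    ...       | no v≰R′ = contradiction
      (subst (v ≤_) (sym (Invariant.others-full inv (next a) R′ (next≢ a) fws[a′]≡))
             (≤-trans v≤T (<⇒≤ T<c)))
      v≰R′

    after-slot : ∀ {P t ows v tx V D a′ fws′ f} → All (λ v → 0ℚ ≤ v × v ≤ T) tx →
                 (os : OptSlot P t ows v tx V) →
                 Invariant a′ fws′ (OptSlot.wallets′ os) (D + α * f - OptSlot.gain os) →
                 V ≤ α * (f + runFWF c F a′ fws′ tx) + D
    after-slot {P} {t} {tx = tx} {D = D} {a′} {fws′} {f} tx-ok os inv′ =
      amortized-slot {g = gain} {α = α} {W = runFWF c F a′ fws′ tx} {D = D} {f = f} value
        (opt≤α*fwf+credit P tx (suc t) a′ fws′ wallets′ _ rest tx-ok bounded inv′ run-rest)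
      where open OptSlot os

  initial-invariant : ∀ ows → Invariant zero (replicate k (online c)) ows 0ℚ
  initial-invariant ows = record
    { active       = λ R full → let R≡c = sym (online-injective (trans (sym (at zero)) full)) in
                       ≤-reflexive R≡c ,
                       ≤-reflexive (trans (cong (λ R → (α - 1ℚ) * (c - R)) R≡c) (nothing-spent α c))
    ; others-full  = λ i R _ full → sym (online-injective (trans (sym (at i)) full))
    ; offline-≤F′  = λ i n away → contradiction (trans (sym (at i)) away) online≢offline
    ; offline-paid = λ d _ n away → contradiction (trans (sym (at (next^ d zero))) away) online≢offline
    }
    where
    at : ∀ i → lookup (replicate k (online c)) i ≡ online c
    at i = Vec.lookup-replicate i (online c)
    online-injective : ∀ {R R′} → online R ≡ online R′ → R ≡ R′
    online-injective refl = refl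
    nothing-spent : ∀ α c → (α - 1ℚ) * (c - c) ≡ 0ℚ
    nothing-spent = solve-∀ ℚ-ring

  initial-bounded : Bounded (initial C k)
  initial-bounded i = subst WithinCapacity (sym (Vec.lookup-replicate i (online (cap C k))))
    (subst (λ x → 0ℚ ≤ x × x ≤ c) (sym cap≡c) (≤-trans 0≤T (<⇒≤ T<c) , ≤-refl))

  flushWhenFull-competitive : ∀ tx → All (λ v → 0ℚ ≤ v × v ≤ T) tx →
                              ∀ V → Achievable C k F tx V →
                              V ≤ α * runFWF c F zero (replicate k (online c)) tx + 0ℚ
  flushWhenFull-competitive tx tx-ok V (P , run) =
    opt≤α*fwf+credit P tx 0 zero _ _ 0ℚ V tx-ok initial-bounded (initial-invariant _) run

ratio-covers-cycle : ∀ {C T K c N} → 0ℚ < C → 0ℚ ≤ T → 0ℚ < K → K * c ≡ C → T < c →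
                     N ≡ 1ℚ + K →
                     C + (c - T) ≤ (N ÷₀ (K * (1ℚ - (K * T) ÷₀ C))) * (K * (c - T))
ratio-covers-cycle {C} {T} {K} {c} {N} 0<C 0≤T 0<K K*c≡C T<c N≡1+K = begin
  C + (c - T)                ≤⟨ +-monoʳ-≤ C (p-q≤p c 0≤T) ⟩
  C + c                      ≡⟨ cong (_+ c) K*c≡C ⟨
  K * c + c                  ≡⟨ +-comm (K * c) c ⟩
  c + K * c                  ≡⟨ distrib c K ⟨
  (1ℚ + K) * c               ≡⟨ cong (_* c) αX≡1+K ⟨
  α * X * c                  ≡⟨ *-assoc α X c ⟩
  α * (X * c)                ≡⟨ cong (α *_) K[c-T]≡Xc ⟨
  α * (K * (c - T))          ∎
  where
  open ≤-Reasoning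
  r X α : ℚ
  r = (K * T) ÷₀ C
  X = K * (1ℚ - r)
  α = N ÷₀ X
  distrib : ∀ c K → (1ℚ + K) * c ≡ c + K * c
  distrib = solve-∀ ℚ-ring
  r*C≡K*T : r * C ≡ K * T
  r*C≡K*T = ÷₀-*-cancel (K * T) (λ C≡0 → <-irrefl (sym C≡0) 0<C)
  r<1 : r < 1ℚ
  r<1 = *-cancelʳ-<-nonNeg C {{nonNegative (<⇒≤ 0<C)}}
          (subst₂ _<_ (sym r*C≡K*T) (trans K*c≡C (sym (*-identityˡ C)))
                  (*-monoʳ-<-pos K {{positive 0<K}} T<c))
  0<X : 0ℚ < X
  0<X = positive⁻¹ X {{pos*pos⇒pos K {{positive 0<K}} (1ℚ - r)
                         {{positive (subst (_< 1ℚ - r) (+-inverseʳ r) (+-monoˡ-< (- r) r<1))}}}}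
  αX≡1+K : α * X ≡ 1ℚ + K
  αX≡1+K = trans (÷₀-*-cancel N (λ X≡0 → <-irrefl (sym X≡0) 0<X)) N≡1+K
  K[c-T]≡Xc : K * (c - T) ≡ X * c
  K[c-T]≡Xc = begin-equality
    K * (c - T)            ≡⟨ expand K c T ⟩
    K * c - K * T          ≡⟨ cong (λ x → K * c - x) (trans (sym r*C≡K*T) (cong (r *_) (sym K*c≡C))) ⟩
    K * c - r * (K * c)    ≡⟨ collect K c r ⟩
    X * c                  ∎
    where
    expand : ∀ K c T → K * (c - T) ≡ K * c - K * T
    expand = solve-∀ ℚ-ring
    collect : ∀ K c r → K * c - r * (K * c) ≡ K * (1ℚ - r) * c
    collect = solve-∀ ℚ-ring

theorem2 : (C : ℚ) (k : ℕ) (T : ℚ) (F : ℕ) →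
    0ℚ < C → 1 ℕ.< k → 0ℚ < T → T < cap C k → 1 ℕ.≤ F →
    let r = (ℕ→ℚ k * T) ÷₀ C
        α = ℕ→ℚ (suc k) ÷₀ (ℕ→ℚ k * (1ℚ - r))
    in ∃[ c ] ((tx : List ℚ) → All (λ v → 0ℚ ≤ v × v ≤ T) tx →
         (V : ℚ) → Achievable C k F tx V →
         V ≤ α * V-FWF C k F tx + c)
theorem2 C 1 T F _ (ℕ.s≤s ()) _ _ _
theorem2 C (suc (suc m′)) T (suc F′) 0<C _ 0<T T<c _ =
  0ℚ , FlushWhenFullAnalysis.flushWhenFull-competitive C (cap C k) T α m′ F′ refl 0≤T T<c
         (ratio-covers-cycle 0<C 0≤T (ℕ→ℚ-pos (suc m′)) (ℕ→ℚ-*-cap C (suc m′)) T<c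
                             (ℕ→ℚ-suc k))
  where
  k : ℕ
  k = suc (suc m′)
  α : ℚ
  α = ℕ→ℚ (suc k) ÷₀ (ℕ→ℚ k * (1ℚ - (ℕ→ℚ k * T) ÷₀ C))
  0≤T : 0ℚ ≤ T
  0≤T = <⇒≤ 0<T
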